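{- Let $(X,\le)$ be a non-empty strictly inductive poset, let $a_0\in X$ and let $f:X\to X$. Let $W$ be the set of elements $x\in X$ such that $x=\mathrm{lub}(C)$ for some $a_0$-chain $C$, and let $N$ be the smallest subset of $X$ containing $a_0$, closed by $f$ and closed by non-empty lubs. Then $W\subseteq N$.
   Context: A poset $(X,\le)$ is strictly inductive if every non-empty chain (totally ordered subset) $Y\subseteq X$ has a least upper bound $\mathrm{lub}(Y)\in X$. A subset $Z\subseteq X$ is closed by $f$ if $f(z)\in Z$ for all $z\in Z$, and closed by non-empty lubs if for every non-empty $P\subseteq Z$, $\mathrm{lub}(P)$ exists and belongs to $Z$. A set $C\subseteq X$ is an $a_0$-chain (with respect to $f$) if: $C$ is well ordered by $\le$; $a_0$ is the least element of $C$; $C$ is closed by non-empty lubs; and for every $z\in C\setminus\{\mathrm{lub}(C)\}$ we have $f(z)\in C$, $z<f(z)$, and there is no $y\in C$ with $z<y<f(z)$. -}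

module Defs where

open import Level using (0ℓ)
open import Data.Product using (Σ; ∃; _×_)
open import Data.Sum using (_⊎_)
open import Relation.Nullary using (¬_)
open import Relation.Unary using (Pred; _⊆_; Satisfiable)
open import Relation.Binary.PropositionalEquality using (_≡_)

module _ {X : Set} (_≤_ : X → X → Set) where

  _<_ : X → X → Set
  x < y = x ≤ y × ¬ (x ≡ y)

  IsUpperBound : Pred X 0ℓ → X → Set
  IsUpperBound S u = ∀ {y} → S y → y ≤ u

  IsLub : Pred X 0ℓ → X → Set
  IsLub S x = IsUpperBound S x × (∀ u → IsUpperBound S u → x ≤ u)

  IsLeast : Pred X 0ℓ → X → Set
  IsLeast S m = S m × (∀ {y} → S y → m ≤ y)

  IsChain : Pred X 0ℓ → Set
  IsChain S = ∀ {y z} → S y → S z → (y ≤ z) ⊎ (z ≤ y)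

  StrictlyInductive : Set₁
  StrictlyInductive = ∀ (Y : Pred X 0ℓ) → Satisfiable Y → IsChain Y → ∃ (IsLub Y)

  WellOrdered : Pred X 0ℓ → Set₁
  WellOrdered C = IsChain C × (∀ (P : Pred X 0ℓ) → P ⊆ C → Satisfiable P → ∃ (IsLeast P))

  ClosedBy : (X → X) → Pred X 0ℓ → Set
  ClosedBy f Z = ∀ {z} → Z z → Z (f z)

  ClosedByNonEmptyLubs : Pred X 0ℓ → Set₁
  ClosedByNonEmptyLubs Z =
    ∀ (P : Pred X 0ℓ) → P ⊆ Z → Satisfiable P → Σ X (λ x → IsLub P x × Z x)

  IsA0Chain : X → (X → X) → Pred X 0ℓ → Set₁
  IsA0Chain a₀ f C =
    WellOrdered C ×
    IsLeast C a₀ ×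
    ClosedByNonEmptyLubs C ×
    (∀ {z} → C z → (∀ l → IsLub C l → ¬ (z ≡ l)) →
       C (f z) × (z < f z) × ¬ (∃ λ y → C y × (z < y) × (y < f z)))

  W : X → (X → X) → Pred X (Level.suc 0ℓ)
  W a₀ f x = ∃ λ (C : Pred X 0ℓ) → IsA0Chain a₀ f C × IsLub C x

  -- N = smallest subset containing a₀, closed by f and by non-empty lubs,
  -- i.e. the intersection of all such subsets
  N : X → (X → X) → Pred X (Level.suc 0ℓ)
  N a₀ f x = ∀ (Z : Pred X 0ℓ) → Z a₀ → ClosedBy f Z → ClosedByNonEmptyLubs Z → Z x

module Submission where

-- Fix an a₀-chain C with lub x and a set Z that contains a₀
-- and is closed by f and by non-empty lubs; we show x ∈ Z.  It suffices to
-- prove C ⊆ Z, since then x, the lub of the non-empty C ⊆ Z, lies in Z.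
-- Because C is well ordered, C ⊆ Z follows by transfinite induction along C
-- (classically: a least counterexample would contradict the induction step).
-- For the induction step at m ∈ C, assume every c ∈ C with c < m is in Z.
-- If m = a₀ we are done.  Otherwise the set B of elements of C below m is
-- non-empty, so its lub l lies in C (C is closed by lubs) and in Z (Z is).
-- If l = m we are done; otherwise l < m, so l is not the top of C and
-- f l ∈ C is the immediate successor of l in C.  Comparing f l with m:
-- f l < m would put f l in B, forcing f l ≤ l; m < f l would put m strictly
-- between l and f l; hence m = f l ∈ Z.

open import Defs
open import Level using (0ℓ)
open import Axiom.ExcludedMiddle using (ExcludedMiddle)
open import Relation.Unary using (Pred; _⊆_)
open import Relation.Binary.PropositionalEquality using (_≡_; sym; subst)
open import Relation.Binary.Structures using (IsPartialOrder)
open import Relation.Nullary using (¬_; yes; no)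
open import Data.Product using (∃; _×_; _,_; proj₁; proj₂)
open import Data.Sum using (_⊎_; inj₁; inj₂)
open import Data.Empty using (⊥-elim)

module PartialOrderFacts {X : Set} {_≤_ : X → X → Set}
                         (po : IsPartialOrder _≡_ _≤_) where

  open IsPartialOrder po using (antisym)

  _⊏_ : X → X → Set
  x ⊏ y = _<_ _≤_ x y

  ⊏-asym : ∀ {x y} → x ⊏ y → ¬ (y ≤ x)
  ⊏-asym (x≤y , x≢y) y≤x = x≢y (antisym x≤y y≤x)

  lub-unique : ∀ {S : Pred X 0ℓ} {a b} → IsLub _≤_ S a → IsLub _≤_ S b → a ≡ b
  lub-unique (a-ub , a-least) (b-ub , b-least) =
    antisym (a-least _ b-ub) (b-least _ a-ub)

  lub∈ : ∀ {Z P : Pred X 0ℓ} {l} → ClosedByNonEmptyLubs _≤_ Z →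
         P ⊆ Z → ∃ P → IsLub _≤_ P l → Z l
  lub∈ {Z} {P} closed P⊆Z p l-lub with closed P P⊆Z p
  ... | l' , l'-lub , l'∈Z = subst Z (lub-unique l'-lub l-lub) l'∈Z

  module Classical (em : ExcludedMiddle 0ℓ) where

    ≤⇒≡⊎⊏ : ∀ {x y} → x ≤ y → x ≡ y ⊎ x ⊏ y
    ≤⇒≡⊎⊏ {x} {y} x≤y with em {x ≡ y}
    ... | yes x≡y = inj₁ x≡y
    ... | no  x≢y = inj₂ (x≤y , x≢y)

    wellOrdered-induction :
      ∀ {C Z : Pred X 0ℓ} → WellOrdered _≤_ C →
      (∀ {m} → C m → (∀ {c} → C c → c ⊏ m → Z c) → Z m) → C ⊆ Z
    wellOrdered-induction {C} {Z} (_ , hasLeast) step {z} z∈C with em {Z z}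
    ... | yes z∈Z = z∈Z
    ... | no  z∉Z with hasLeast (λ c → C c × ¬ Z c) proj₁ (z , z∈C , z∉Z)
    ...   | m , (m∈C , m∉Z) , m-least = ⊥-elim (m∉Z (step m∈C below-m∈Z))
      where
      below-m∈Z : ∀ {c} → C c → c ⊏ m → Z c
      below-m∈Z {c} c∈C c⊏m with em {Z c}
      ... | yes c∈Z = c∈Z
      ... | no  c∉Z = ⊥-elim (⊏-asym c⊏m (m-least (c∈C , c∉Z)))

    module A0ChainStep {a₀ : X} {f : X → X} {C Z : Pred X 0ℓ}
                       (C-a0 : IsA0Chain _≤_ a₀ f C)
                       (a₀∈Z : Z a₀) (Z-f : ClosedBy _≤_ f Z)
                       (Z-lubs : ClosedByNonEmptyLubs _≤_ Z) where

      private
        C-chain : IsChain _≤_ C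
        C-chain = proj₁ (proj₁ C-a0)

        a₀-least : IsLeast _≤_ C a₀
        a₀-least = proj₁ (proj₂ C-a0)

        C-lubs : ClosedByNonEmptyLubs _≤_ C
        C-lubs = proj₁ (proj₂ (proj₂ C-a0))

        successor : ∀ {z} → C z → (∀ t → IsLub _≤_ C t → ¬ (z ≡ t)) →
                    C (f z) × z ⊏ f z × ¬ (∃ λ y → C y × z ⊏ y × y ⊏ f z)
        successor = proj₂ (proj₂ (proj₂ C-a0))

      Below : X → Pred X 0ℓ
      Below m c = C c × c ⊏ m

      a₀∈Below : ∀ {m} → a₀ ⊏ m → Below m a₀
      a₀∈Below a₀⊏m = proj₁ a₀-least , a₀⊏m

      -- an element strictly below some m ∈ C is not the lub of C, so the
      -- successor clause of the a₀-chain applies to it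
      not-top : ∀ {l m} → C m → l ⊏ m → ∀ t → IsLub _≤_ C t → ¬ (l ≡ t)
      not-top m∈C l⊏m t t-lub l≡t =
        ⊏-asym l⊏m (subst (_ ≤_) (sym l≡t) (proj₁ t-lub m∈C))

      -- if the lub l of the predecessors of m ∈ C is strictly below m, then m
      -- is the successor f l: f l < m is excluded since f l would be a
      -- predecessor, m < f l since nothing of C lies strictly between l and f l
      ≡successor : ∀ {m l} → C m → IsLub _≤_ (Below m) l → C l → l ⊏ m → m ≡ f l
      ≡successor {m} {l} m∈C l-lub l∈C l⊏m
        with successor l∈C (not-top m∈C l⊏m)
      ... | fl∈C , l⊏fl , nothing-between = compare (C-chain fl∈C m∈C)
        where
        compare : f l ≤ m ⊎ m ≤ f l → m ≡ f l
        compare (inj₁ fl≤m) with ≤⇒≡⊎⊏ fl≤m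
        ... | inj₁ fl≡m = sym fl≡m
        ... | inj₂ fl⊏m = ⊥-elim (⊏-asym l⊏fl (proj₁ l-lub (fl∈C , fl⊏m)))
        compare (inj₂ m≤fl) with ≤⇒≡⊎⊏ m≤fl
        ... | inj₁ m≡fl = m≡fl
        ... | inj₂ m⊏fl = ⊥-elim (nothing-between (m , m∈C , l⊏m , m⊏fl))

      lub-Below∈Z : ∀ {m l} → (∀ {c} → C c → c ⊏ m → Z c) → a₀ ⊏ m →
                    IsLub _≤_ (Below m) l → Z l
      lub-Below∈Z below-m∈Z a₀⊏m =
        lub∈ Z-lubs (λ (c∈C , c⊏m) → below-m∈Z c∈C c⊏m) (a₀ , a₀∈Below a₀⊏m)

      step : ∀ {m} → C m → (∀ {c} → C c → c ⊏ m → Z c) → Z m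
      step {m} m∈C below-m∈Z with ≤⇒≡⊎⊏ (proj₂ a₀-least m∈C)
      ... | inj₁ a₀≡m = subst Z a₀≡m a₀∈Z
      ... | inj₂ a₀⊏m with C-lubs (Below m) proj₁ (a₀ , a₀∈Below a₀⊏m)
      ...   | l , l-lub , l∈C
        with ≤⇒≡⊎⊏ (proj₂ l-lub m (λ (_ , c⊏m) → proj₁ c⊏m))
           | lub-Below∈Z below-m∈Z a₀⊏m l-lub
      ...     | inj₁ l≡m | l∈Z = subst Z l≡m l∈Z
      ...     | inj₂ l⊏m | l∈Z =
        subst Z (sym (≡successor m∈C l-lub l∈C l⊏m)) (Z-f l∈Z)

      a₀-chain⊆Z : C ⊆ Z
      a₀-chain⊆Z = wellOrdered-induction (proj₁ C-a0) step

lemma5 : ExcludedMiddle 0ℓ →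
    (X : Set) (_≤_ : X → X → Set) → IsPartialOrder _≡_ _≤_ →
    X → StrictlyInductive _≤_ →
    (a₀ : X) (f : X → X) →
    W _≤_ a₀ f ⊆ N _≤_ a₀ f
lemma5 em X _≤_ po _ _ a₀ f (C , C-a0 , x-lub) Z a₀∈Z Z-f Z-lubs =
  lub∈ Z-lubs a₀-chain⊆Z (a₀ , proj₁ (proj₁ (proj₂ C-a0))) x-lub
  where
  open PartialOrderFacts po
  open Classical em
  open A0ChainStep C-a0 a₀∈Z Z-f Z-lubs
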